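{- If $G$ is an infinite graph, then $\psi(G)=\infty$; that is, $G$ has no finite doubly resolving set.
   Context: All graphs are simple, connected and locally finite. $d$ is the shortest-path distance. Two vertices $x,y$ doubly resolve a pair of vertices $u,v$ if $d(u,x)-d(v,x)\neq d(u,y)-d(v,y)$. A set $S$ of vertices is a doubly resolving set of $G$ if every pair of distinct vertices of $G$ is doubly resolved by two vertices of $S$. $\psi(G)$ is the minimum cardinality of a doubly resolving set if $G$ has a finite one, and $\psi(G)=\infty$ otherwise. -}

module Defs where

open import Data.Nat using (ℕ; zero; suc; _≤_)
open import Data.Integer using (ℤ; +_; _-_)
open import Data.List using (List)
open import Data.List.Membership.Propositional using (_∈_)
open import Data.List.Relation.Unary.All using (All)
open import Data.Product using (Σ; ∃; _×_)
open import Relation.Nullary using (¬_)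
open import Relation.Binary.PropositionalEquality using (_≡_; _≢_)

record Graph : Set₁ where
  field
    V     : Set
    Adj   : V → V → Set
    irrefl : ∀ v → ¬ Adj v v
    sym    : ∀ {u v} → Adj u v → Adj v u

module _ (G : Graph) where
  open Graph G

  data Walk : V → V → ℕ → Set where
    here : ∀ {v} → Walk v v zero
    step : ∀ {u w v n} → Adj u w → Walk w v n → Walk u v (suc n)

  Connected : Set
  Connected = ∀ u v → ∃ λ n → Walk u v n

  LocallyFinite : Set
  LocallyFinite = ∀ v → Σ (List V) λ L → ∀ w → Adj v w → w ∈ L

  FiniteGraph : Set
  FiniteGraph = Σ (List V) λ L → ∀ v → v ∈ L

  InfiniteGraph : Set
  InfiniteGraph = ¬ FiniteGraph

  Dist : V → V → ℕ → Set
  Dist u v n = Walk u v n × (∀ m → Walk u v m → n ≤ m)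

  DoublyResolves : V → V → V → V → Set
  DoublyResolves x y u v =
    ∀ a b c e → Dist u x a → Dist v x b → Dist u y c → Dist v y e →
    (+ a) - (+ b) ≢ (+ c) - (+ e)

  IsDoublyResolvingSet : List V → Set
  IsDoublyResolvingSet S =
    ∀ u v → u ≢ v → ∃ λ x → ∃ λ y → x ∈ S × y ∈ S × DoublyResolves x y u v

  NoFiniteDoublyResolvingSet : Set
  NoFiniteDoublyResolvingSet = ¬ (Σ (List V) λ S → IsDoublyResolvingSet S)

module Submission where

-- Fix a finite set S, a base vertex v₀ and a radius R such that every s ∈ S
-- is reachable from v₀ by a walk of length at most R.  For a vertex u put
-- p = d(u,v₀) and, for s ∈ S, the excess  d(u,s) + R − p.  The triangle
-- inequality places every excess in [0, 2R], so the tuple of excesses (the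
-- signature of u) takes at most N = (2R+1)^|S| values.  If u and v have the
-- same signature then d(u,s) − d(v,s) = d(u,v₀) − d(v,v₀) for every s ∈ S,
-- so no two vertices of S doubly resolve u and v.  Hence, when S is doubly
-- resolving, distinct vertices have distinct signatures and G has at most N
-- vertices (pigeonhole).  On the other hand, in a connected, locally finite,
-- infinite graph the balls around v₀ grow forever, so G contains N + 1
-- distinct vertices.
--
-- Distances exist only classically (adjacency need not be decidable), so the
-- argument runs in the double-negation monad, which suffices since the goal
-- is a negation.

open import Defs
open import Level using (0ℓ)
open import Data.Nat using (ℕ; zero; suc; _+_; _∸_; _^_; _≤_; _<_; s≤s)
open import Data.Nat.Properties
  using (≤-refl; ≤-trans; ≮⇒≥; m≤m+n; m≤n+m; +-assoc; +-comm; +-monoʳ-≤;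
         +-monoˡ-≤; +-cancelʳ-≡; ∸-monoˡ-≤; m∸n+n≡m; m+n∸m≡n)
open import Data.Nat.Induction using (<-rec)
open import Data.Integer using (+_; _-_; _⊖_)
open import Data.Integer.Properties using ([+m]-[+n]≡m⊖n; +-cancelˡ-⊖)
open import Data.Fin using (Fin; toℕ; fromℕ<; combine)
import Data.Fin as Fin
open import Data.Fin.Properties using (toℕ-fromℕ<; combine-injective; pigeonhole)
  renaming (<⇒≢ to fin-<⇒≢)
open import Data.List using (List; []; _∷_; _++_; [_]; length; concatMap)
open import Data.List.Membership.Propositional using (_∈_; _∉_)
open import Data.List.Membership.Propositional.Properties using (∈-++⁺ˡ; ∈-++⁺ʳ; ∈-concatMap⁺)
open import Data.List.Relation.Binary.Subset.Propositional using (_⊆_)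
open import Data.List.Relation.Unary.Any as Any using (here; there)
open import Data.List.Relation.Unary.All as All using (All; []; _∷_)
open import Data.List.Relation.Unary.All.Properties using (lookup-map)
open import Data.Product using (Σ; ∃; _×_; _,_; proj₁; proj₂)
open import Data.Sum using (_⊎_; inj₁; inj₂)
open import Data.Empty using (⊥; ⊥-elim)
open import Effect.Monad using (RawMonad)
open import Function.Definitions using (Injective)
open import Data.Vec.Functional using () renaming (_∷_ to _∷ᶠ_)
open import Relation.Nullary using (¬_; yes; no)
open import Relation.Nullary.Decidable using (¬¬-excluded-middle)
open import Relation.Nullary.Negation using (¬¬-Monad)
open import Relation.Binary.PropositionalEquality
  using (_≡_; _≢_; refl; cong; cong₂; trans; subst; module ≡-Reasoning)
  renaming (sym to ≡-sym)
open import Data.Nat.Tactic.RingSolver using (solve-∀)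

open RawMonad (¬¬-Monad {0ℓ}) using (pure; _>>=_; _<$>_)

¬¬-tabulate : ∀ n {P : Fin n → Set} → (∀ i → ¬ ¬ P i) → ¬ ¬ (∀ i → P i)
¬¬-tabulate zero        choose = pure (λ ())
¬¬-tabulate (suc n) {P} choose = do
  p₀ ← choose Fin.zero
  ps ← ¬¬-tabulate n {λ i → P (Fin.suc i)} (λ i → choose (Fin.suc i))
  pure (λ { Fin.zero → p₀ ; (Fin.suc i) → ps i })

least-witness : (P : ℕ → Set) → ∀ {n} → P n →
                ¬ ¬ (∃ λ m → P m × (∀ k → P k → m ≤ k))
least-witness P {n} = <-rec (λ n → P n → ¬ ¬ Least) descend n
  where
  Least : Set
  Least = ∃ λ m → P m × (∀ k → P k → m ≤ k)

  descend : ∀ n → (∀ {j} → j < n → P j → ¬ ¬ Least) → P n → ¬ ¬ Least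
  descend n smaller pn = ¬¬-excluded-middle {A = ∃ λ j → j < n × P j} >>= λ
    { (yes (j , j<n , pj)) → smaller j<n pj
    ; (no nothing-below)   →
        pure (n , pn , λ k pk → ≮⇒≥ (λ k<n → nothing-below (k , k<n , pk))) }

included-or-escapes : {A : Set} (xs ys : List A) →
                      ¬ ¬ (xs ⊆ ys ⊎ ∃ λ x → x ∈ xs × x ∉ ys)
included-or-escapes []       ys = pure (inj₁ (λ ()))
included-or-escapes (x ∷ xs) ys = ¬¬-excluded-middle {A = x ∈ ys} >>= λ
  { (no x∉ys) → pure (inj₂ (x , here refl , x∉ys))
  ; (yes x∈ys) → extend x∈ys <$> included-or-escapes xs ys }
  where
  extend : ∀ {x xs ys} → x ∈ ys → xs ⊆ ys ⊎ (∃ λ z → z ∈ xs × z ∉ ys) →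
           (x ∷ xs) ⊆ ys ⊎ (∃ λ z → z ∈ x ∷ xs × z ∉ ys)
  extend x∈ys (inj₁ xs⊆ys) = inj₁ λ { (here refl) → x∈ys ; (there z∈xs) → xs⊆ys z∈xs }
  extend x∈ys (inj₂ (z , z∈xs , z∉ys)) = inj₂ (z , there z∈xs , z∉ys)

excess-bound : ∀ {a p R} → a ≤ p + R → a + R ∸ p ≤ R + R
excess-bound {a} {p} {R} a≤p+R = begin
  a + R ∸ p       ≤⟨ ∸-monoˡ-≤ p (+-monoˡ-≤ R a≤p+R) ⟩
  p + R + R ∸ p   ≡⟨ cong (_∸ p) (+-assoc p R R) ⟩
  p + (R + R) ∸ p ≡⟨ m+n∸m≡n p (R + R) ⟩
  R + R           ∎
  where open Data.Nat.Properties.≤-Reasoning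

excess-cancel : ∀ {a b p q R} → p ≤ a + R → q ≤ b + R →
                a + R ∸ p ≡ b + R ∸ q → a + q ≡ b + p
excess-cancel {a} {b} {p} {q} {R} p≤a+R q≤b+R same = +-cancelʳ-≡ R (a + q) (b + p) (begin
  a + q + R                 ≡⟨ swap-last a q R ⟩
  a + R + q                 ≡⟨ cong (_+ q) (≡-sym (m∸n+n≡m p≤a+R)) ⟩
  a + R ∸ p + p + q         ≡⟨ cong (λ t → t + p + q) same ⟩
  b + R ∸ q + p + q         ≡⟨ swap-last (b + R ∸ q) p q ⟩
  b + R ∸ q + q + p         ≡⟨ cong (_+ p) (m∸n+n≡m q≤b+R) ⟩
  b + R + p                 ≡⟨ swap-last b R p ⟩
  b + p + R                 ∎)
  where
  open ≡-Reasoning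
  swap-last : ∀ x y z → x + y + z ≡ x + z + y
  swap-last = solve-∀

difference-swap : ∀ {a b p q} → a + q ≡ b + p → (+ a) - (+ b) ≡ (+ p) - (+ q)
difference-swap {a} {b} {p} {q} eq = begin
  (+ a) - (+ b)       ≡⟨ [+m]-[+n]≡m⊖n a b ⟩
  a ⊖ b               ≡⟨ ≡-sym (+-cancelˡ-⊖ q a b) ⟩
  (q + a) ⊖ (q + b)   ≡⟨ cong₂ _⊖_ (trans (+-comm q a) eq) (+-comm q b) ⟩
  (b + p) ⊖ (b + q)   ≡⟨ +-cancelˡ-⊖ b p q ⟩
  p ⊖ q               ≡⟨ ≡-sym ([+m]-[+n]≡m⊖n p q) ⟩
  (+ p) - (+ q)       ∎
  where open ≡-Reasoning

encode : ∀ {A : Set} {m} {xs : List A} → All (λ _ → Fin m) xs → Fin (m ^ length xs)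
encode []       = Fin.zero
encode (i ∷ is) = combine i (encode is)

encode-injective : ∀ {A : Set} {m} {xs : List A} (is js : All (λ _ → Fin m) xs) →
                   encode is ≡ encode js → is ≡ js
encode-injective []       []       _    = refl
encode-injective (i ∷ is) (j ∷ js) same with combine-injective i (encode is) j (encode js) same
... | i≡j , codes≡ = cong₂ _∷_ i≡j (encode-injective is js codes≡)

module Walks (G : Graph) where
  open Graph G using (V; Adj) renaming (sym to adj-sym)

  infixr 5 _++ʷ_

  _▷_ : ∀ {u v w n} → Walk G u v n → Adj v w → Walk G u w (suc n)
  here       ▷ e = step e here
  step e′ ws ▷ e = step e′ (ws ▷ e)

  reverse : ∀ {u v n} → Walk G u v n → Walk G v u n
  reverse here        = here
  reverse (step e ws) = reverse ws ▷ adj-sym e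

  _++ʷ_ : ∀ {u v w n m} → Walk G u v n → Walk G v w m → Walk G u w (n + m)
  here      ++ʷ ws′ = ws′
  step e ws ++ʷ ws′ = step e (ws ++ʷ ws′)

  dist-exists : Connected G → ∀ u v → ¬ ¬ ∃ (Dist G u v)
  dist-exists conn u v = least-witness (Walk G u v) (proj₂ (conn u v))

  Within : ℕ → V → V → Set
  Within R v₀ s = ∃ λ n → n ≤ R × Walk G v₀ s n

  equal-shifts⇒unresolved : ∀ {u v x y a b c e p q} →
    Dist G u x a → Dist G v x b → Dist G u y c → Dist G v y e →
    a + q ≡ b + p → c + q ≡ e + p → ¬ DoublyResolves G x y u v
  equal-shifts⇒unresolved {a = a} {b} {c} {e} {p} {q} dux dvx duy dvy shift-x shift-y resolves =
    resolves a b c e dux dvx duy dvy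
      (trans (difference-swap {a} {b} {p} {q} shift-x) (≡-sym (difference-swap {c} {e} {p} {q} shift-y)))

  common-radius : Connected G → ∀ v₀ (xs : List V) → ∃ λ R → All (Within R v₀) xs
  common-radius conn v₀ []       = 0 , []
  common-radius conn v₀ (x ∷ xs) with conn v₀ x | common-radius conn v₀ xs
  ... | n , w | R , within =
    n + R , (n , m≤m+n n R , w) ∷ All.map (λ { (k , k≤R , wk) → k , ≤-trans k≤R (m≤n+m R n) , wk }) within

module Balls (G : Graph) (conn : Connected G) (lf : LocallyFinite G) (v₀ : Graph.V G) where
  open Graph G using (V; Adj)

  neighbours : V → List V
  neighbours v = proj₁ (lf v)

  ball : ℕ → List V
  ball zero    = [ v₀ ]
  ball (suc n) = ball n ++ concatMap neighbours (ball n)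

  centre∈ball : ∀ n → v₀ ∈ ball n
  centre∈ball zero    = here refl
  centre∈ball (suc n) = ∈-++⁺ˡ (centre∈ball n)

  neighbour∈next-ball : ∀ {n x y} → x ∈ ball n → Adj x y → y ∈ ball (suc n)
  neighbour∈next-ball {n} {x} {y} x∈ball e =
    ∈-++⁺ʳ (ball n) (∈-concatMap⁺ neighbours (Any.map (λ { refl → proj₂ (lf x) y e }) x∈ball))

  saturated⇒everything : ∀ {n} → ball (suc n) ⊆ ball n → ∀ v → v ∈ ball n
  saturated⇒everything {n} stable v = reach (centre∈ball n) (proj₂ (conn v₀ v))
    where
    reach : ∀ {u w k} → u ∈ ball n → Walk G u w k → w ∈ ball n
    reach u∈ball here        = u∈ball
    reach u∈ball (step e ws) = reach (stable (neighbour∈next-ball {n} u∈ball e)) ws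

  DistinctIn : ℕ → Set
  DistinctIn n = Σ (Fin n → V) λ X → Injective _≡_ _≡_ X × (∀ i → X i ∈ ball n)

  add-new : ∀ {n x} → DistinctIn n → x ∈ ball (suc n) → x ∉ ball n → DistinctIn (suc n)
  add-new {n} {x} (X , X-inj , X∈ball) x∈ball x∉ball = x ∷ᶠ X , injective , inside
    where
    injective : Injective _≡_ _≡_ (x ∷ᶠ X)
    injective {Fin.zero}  {Fin.zero}  _    = refl
    injective {Fin.zero}  {Fin.suc j} same = ⊥-elim (x∉ball (subst (_∈ ball n) (≡-sym same) (X∈ball j)))
    injective {Fin.suc i} {Fin.zero}  same = ⊥-elim (x∉ball (subst (_∈ ball n) same (X∈ball i)))
    injective {Fin.suc i} {Fin.suc j} same = cong Fin.suc (X-inj same)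

    inside : ∀ i → (x ∷ᶠ X) i ∈ ball (suc n)
    inside Fin.zero    = x∈ball
    inside (Fin.suc i) = ∈-++⁺ˡ (X∈ball i)

  -- In an infinite graph the balls never stabilise, so each ball n contains,
  -- classically, n distinct vertices.
  distinct-in-ball : InfiniteGraph G → ∀ n → ¬ ¬ DistinctIn n
  distinct-in-ball infinite zero    = pure ((λ ()) , (λ { {()} }) , (λ ()))
  distinct-in-ball infinite (suc n) = do
    old ← distinct-in-ball infinite n
    inj₂ (x , x∈ball , x∉ball) ← included-or-escapes (ball (suc n)) (ball n)
      where inj₁ stable → ⊥-elim (infinite (ball n , saturated⇒everything {n} stable))
    pure (add-new {n} old x∈ball x∉ball)

module Signatures (G : Graph) (conn : Connected G) (S : List (Graph.V G))
                  (v₀ : Graph.V G) (R : ℕ) (near : All (Walks.Within G R v₀) S) where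
  open Graph G using (V)
  open Walks G

  Sighting : V → V → Set
  Sighting u s = Within R v₀ s × ∃ (Dist G u s)

  Profile : V → Set
  Profile u = ∃ (Dist G u v₀) × All (Sighting u) S

  profile-exists : ∀ u → ¬ ¬ Profile u
  profile-exists u = do
    du ← dist-exists conn u v₀
    sightings ← All.mapM 0ℓ ¬¬-Monad (λ {s} within → (within ,_) <$> dist-exists conn u s) near
    pure (du , sightings)

  -- Triangle inequalities through v₀ and through s: |d(u,v₀) − d(u,s)| ≤ R.
  sighting-bounds : ∀ {u s p a} → Dist G u v₀ p → Within R v₀ s → Dist G u s a →
                    p ≤ a + R × a ≤ p + R
  sighting-bounds {p = p} {a} (wp , p-least) (n , n≤R , w) (wa , a-least) =
    ≤-trans (p-least _ (wa ++ʷ reverse w)) (+-monoʳ-≤ a n≤R) ,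
    ≤-trans (a-least _ (wp ++ʷ w)) (+-monoʳ-≤ p n≤R)

  excess : ∀ {u s} → ∃ (Dist G u v₀) → Sighting u s → Fin (suc (R + R))
  excess (p , dp) (within , (a , da)) =
    fromℕ< (s≤s (excess-bound {a} {p} {R} (proj₂ (sighting-bounds dp within da))))

  toℕ-excess : ∀ {u s p a} (dp : Dist G u v₀ p) (within : Within R v₀ s) (da : Dist G u s a) →
               toℕ (excess (p , dp) (within , (a , da))) ≡ a + R ∸ p
  toℕ-excess dp within da = toℕ-fromℕ< _

  excess-injective : ∀ {u v s} (du : ∃ (Dist G u v₀)) (dv : ∃ (Dist G v v₀))
                     (su : Sighting u s) (sv : Sighting v s) → excess du su ≡ excess dv sv →
                     proj₁ (proj₂ su) + proj₁ dv ≡ proj₁ (proj₂ sv) + proj₁ du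
  excess-injective (p , dp) (q , dq) (wu , (a , da)) (wv , (b , db)) same =
    excess-cancel (proj₁ (sighting-bounds dp wu da)) (proj₁ (sighting-bounds dq wv db))
      (trans (≡-sym (toℕ-excess dp wu da)) (trans (cong toℕ same) (toℕ-excess dq wv db)))

  signature : ∀ {u} → Profile u → All (λ _ → Fin (suc (R + R))) S
  signature (du , sightings) = All.map (excess du) sightings

  code : ∀ {u} → Profile u → Fin (suc (R + R) ^ length S)
  code π = encode (signature π)

  seen : ∀ {u x} → Profile u → x ∈ S → ℕ
  seen (_ , sightings) x∈S = proj₁ (proj₂ (All.lookup sightings x∈S))

  seen-dist : ∀ {u x} (π : Profile u) (x∈S : x ∈ S) → Dist G u x (seen π x∈S)
  seen-dist (_ , sightings) x∈S = proj₂ (proj₂ (All.lookup sightings x∈S))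

  same-signature⇒shift : ∀ {u v x} (πu : Profile u) (πv : Profile v) →
                         signature πu ≡ signature πv → (x∈S : x ∈ S) →
                         seen πu x∈S + proj₁ (proj₁ πv) ≡ seen πv x∈S + proj₁ (proj₁ πu)
  same-signature⇒shift (du , su) (dv , sv) same x∈S =
    excess-injective du dv (All.lookup su x∈S) (All.lookup sv x∈S) (begin
      excess du (All.lookup su x∈S)                ≡⟨ ≡-sym (lookup-map {f = excess du} su x∈S) ⟩
      All.lookup (All.map (excess du) su) x∈S      ≡⟨ cong (λ σ → All.lookup σ x∈S) same ⟩
      All.lookup (All.map (excess dv) sv) x∈S      ≡⟨ lookup-map {f = excess dv} sv x∈S ⟩
      excess dv (All.lookup sv x∈S)                ∎)
    where open ≡-Reasoning

  code-separates : IsDoublyResolvingSet G S → ∀ {u v} → u ≢ v →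
                   (πu : Profile u) (πv : Profile v) → code πu ≢ code πv
  code-separates drs {u} {v} u≢v πu πv same with drs u v u≢v
  ... | x , y , x∈S , y∈S , resolves =
    equal-shifts⇒unresolved
      (seen-dist πu x∈S) (seen-dist πv x∈S) (seen-dist πu y∈S) (seen-dist πv y∈S)
      (same-signature⇒shift πu πv signatures≡ x∈S) (same-signature⇒shift πu πv signatures≡ y∈S)
      resolves
    where
    signatures≡ : signature πu ≡ signature πv
    signatures≡ = encode-injective (signature πu) (signature πv) same

  few-vertices : IsDoublyResolvingSet G S → (X : Fin (suc (suc (R + R) ^ length S)) → V) →
                 ¬ Injective _≡_ _≡_ X
  few-vertices drs X X-inj = ¬¬-tabulate _ (λ i → profile-exists (X i)) λ profiles →
    collide profiles (pigeonhole ≤-refl (λ i → code (profiles i)))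
    where
    collide : (profiles : ∀ i → Profile (X i)) →
              (∃ λ i → ∃ λ j → i Fin.< j × code (profiles i) ≡ code (profiles j)) → ⊥
    collide profiles (i , j , i<j , same) =
      code-separates drs (λ Xi≡Xj → fin-<⇒≢ i<j (X-inj Xi≡Xj)) (profiles i) (profiles j) same

-- Every vertex v₀ yields a contradiction: with R a common radius of S around
-- v₀, the balls around v₀ supply more distinct vertices than signatures
-- exist.  Hence G has no vertex at all and is finite, contradicting
-- infinitude.
corollary1 : (G : Graph) → Connected G → LocallyFinite G → InfiniteGraph G →
    NoFiniteDoublyResolvingSet G
corollary1 G conn lf infinite (S , drs) = infinite ([] , λ v₀ → ⊥-elim (no-vertex v₀))
  where
  no-vertex : Graph.V G → ⊥
  no-vertex v₀ with Walks.common-radius G conn v₀ S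
  ... | R , near =
    distinct-in-ball infinite (suc (suc (R + R) ^ length S)) λ { (X , X-inj , _) →
      few-vertices drs X X-inj }
    where
    open Balls G conn lf v₀ using (distinct-in-ball)
    open Signatures G conn S v₀ R near using (few-vertices)
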